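{- Let $(G,\rho)$ be a reduced maximal Gallai multigraph, $H$ an induced subgraph of $G$, and suppose $H$ has the tree property for $n$. If $(U,V)\in\mathcal A_{n+1}$, then $\rho[UV]=\mathrm{tc}(U)$ and $|\mathrm{tc}(U)|=2$.
   Context: An edge-colored (complete, loopless) multigraph $(G,\rho)$ has a finite vertex set $\mathcal V\subseteq\mathbb N$, ordered by the usual order of $\mathbb N$, and assigns to each unordered pair of distinct vertices $u,v$ a nonempty finite set $\rho[uv]$ of colors (parallel edges have distinct colors). For vertex sets $U,W$ let $\rho[UW]=\bigcup\{\rho[uw]:u\in U,w\in W,u\ne w\}$; a single vertex $u$ is identified with $\{u\}$. Three distinct vertices form a rainbow triangle if one can pick pairwise distinct colors from the three color sets of its sides. $(G,\rho)$ is Gallai if it has no rainbow triangle; maximal if for every pair $u,v$ and color $B\notin\rho[uv]$, adding $B$ to $\rho[uv]$ would create a rainbow triangle; reduced if there is no pair $u,v$ with $\rho[uw]=\rho[vw]$ and $|\rho[uw]|=1$ for all $w\notin\{u,v\}$. Dominance: for disjoint nonempty $U,V\subseteq\mathcal V$, $U\triangleright V$ iff $|\rho[UV]|>1$ and either (a) $U=\{u\}$, $V=\{v\}$, $u<v$, or (b) $|U|>1$ or $|V|>1$, and $\rho[uv]=\rho[uV]$ for all $u\in U,v\in V$. The signature $\Sigma(U,V)$ is the map $u\mapsto\rho[uV]$ on $U$. Mixed graphs: complete means each pair of distinct vertices is joined by exactly one edge, undirected or directed (one direction). Weak components are the components of the graph given by the directed edges with directions forgotten (undirected edges ignored). A rooted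 tree is a transitive directed graph whose transitive reduction is a tree; its root is the unique vertex with a directed edge to every other vertex. For an induced subgraph $H$ define $M_n(H)=(\mathcal V_n,\mathcal E_n,\mathcal A_n)$: $\mathcal V_0=V(H)$, $\mathcal A_0=\{(u,v):u\triangleright v\}$, $\mathcal E_0=\{\{u,v\}:|\rho[uv]|=1\}$; for $n\ge1$, $\mathcal V_n$ is the partition of $V(H)$ whose blocks are the unions of the members of $\mathcal V_{n-1}$ lying in one weak component of $M_{n-1}(H)$, $\mathcal A_n=\{(U,W)\in\mathcal V_n^2:U\triangleright W\}$, $\mathcal E_n=\{\{U,W\}:U\neq W,\ |\rho[UW]|=1\}$. $H$ has the tree property for $n$ if for every $k\le n$: $M_k(H)$ is complete; $|\rho[UW]|=1$ on $\mathcal E_k$ and $=2$ on $\mathcal A_k$; every weak component of $M_k(H)$ with its directed edges is a rooted tree; and $(U,V),(V,W)\in\mathcal A_k$ implies $\Sigma(U,V)=\Sigma(U,W)$. Root notation (given the tree property for $n$): for $1\le k\le n+1$ and $U\in\mathcal V_k$, $\mathrm{tr}(U)$ is the set of members of $\mathcal V_{k-1}$ contained in $U$ (a weak component of $M_{k-1}(H)$, hence a rooted tree) and $\mathrm{rt}(U)\in\mathcal V_{k-1}$ is its root. Tree colors: for $u\in\mathcal V_0$, $\mathrm{tc}(u)=\bigcup\{\rho[uv]:v\in V(H),\ u\triangleright v\}$; for $U\in\mathcal V_k$ with $k\ge1$, $\mathrm{tc}(U)=\mathrm{tc}(\mathrm{rt}(U))$. -}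

module Defs where

open import Data.Nat using (ℕ; zero; suc; _<_; _≤_)
open import Data.List using (List; []; _∷_; length; _∷ʳ_)
open import Data.List.Membership.Propositional using (_∈_; _∉_)
open import Data.List.Relation.Unary.All using (All)
open import Data.List.Relation.Unary.AllPairs using (AllPairs)
open import Data.List.Relation.Unary.Linked using (Linked)
open import Data.List.Relation.Unary.Unique.Propositional using (Unique)
open import Data.Product using (Σ; ∃; ∃-syntax; _×_; _,_)
open import Data.Sum using (_⊎_)
open import Data.Empty using (⊥)
open import Relation.Nullary using (¬_)
open import Relation.Binary.PropositionalEquality using (_≡_; _≢_)
open import Relation.Binary.Construct.Closure.ReflexiveTransitive using (Star)
open import Relation.Binary.Construct.Closure.Equivalence using (EqClosure)

ColorSet : Set₁
ColorSet = ℕ → Set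

VSet : Set₁
VSet = ℕ → Set

_≐_ : ColorSet → ColorSet → Set
S ≐ T = ∀ c → (S c → T c) × (T c → S c)

Card1 : ColorSet → Set
Card1 S = ∃[ a ] (S a × (∀ x → S x → x ≡ a))

CardGt1 : (ℕ → Set) → Set
CardGt1 S = ∃[ a ] ∃[ b ] (S a × S b × a ≢ b)

Card2 : ColorSet → Set
Card2 S = ∃[ a ] ∃[ b ] (a ≢ b × S a × S b × (∀ x → S x → (x ≡ a ⊎ x ≡ b)))

IsSingleton : VSet → ℕ → Set
IsSingleton U u = U u × (∀ x → U x → x ≡ u)

Rainbow3 : ColorSet → ColorSet → ColorSet → Set
Rainbow3 A B C = ∃[ a ] ∃[ b ] ∃[ c ]
  (A a × B b × C c × a ≢ b × b ≢ c × a ≢ c)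

-- Edge-coloured complete loopless multigraphs

record Multigraph : Set where
  field
    V         : List ℕ
    V-unique  : Unique V
    ρ         : ℕ → ℕ → List ℕ
    ρ-sym     : ∀ u v c → c ∈ ρ u v → c ∈ ρ v u
    ρ-nonempty : ∀ u v → u ∈ V → v ∈ V → u ≢ v → ∃[ c ] (c ∈ ρ u v)

module _ (G : Multigraph) where
  open Multigraph G

  col : ℕ → ℕ → ColorSet
  col u v c = c ∈ ρ u v

  Gallai : Set
  Gallai = ∀ u v w → u ∈ V → v ∈ V → w ∈ V → u ≢ v → v ≢ w → u ≢ w →
           ¬ Rainbow3 (col u v) (col v w) (col u w)

  Maximal : Set
  Maximal = ∀ u v → u ∈ V → v ∈ V → u ≢ v → ∀ B → B ∉ ρ u v →
            ∃[ w ] (w ∈ V × w ≢ u × w ≢ v ×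
              Rainbow3 (λ c → c ∈ ρ u v ⊎ c ≡ B) (col v w) (col u w))

  Reduced : Set
  Reduced = ¬ (∃[ u ] ∃[ v ] (u ∈ V × v ∈ V × u ≢ v ×
              (∀ w → w ∈ V → w ≢ u → w ≢ v →
                 (col u w ≐ col v w) × Card1 (col u w))))

  colS : VSet → VSet → ColorSet
  colS U W c = ∃[ u ] ∃[ w ] (U u × W w × u ≢ w × c ∈ ρ u w)

  single : ℕ → VSet
  single u x = x ≡ u

  Dom : VSet → VSet → Set
  Dom U W = CardGt1 (colS U W) ×
    ( (∃[ u ] ∃[ v ] (IsSingleton U u × IsSingleton W v × u < v))
    ⊎ ((CardGt1 U ⊎ CardGt1 W) ×
       (∀ u v → U u → W v → colS (single u) (single v) ≐ colS (single u) W)))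

  SameSig : VSet → VSet → VSet → Set
  SameSig U V′ W = ∀ u → U u → colS (single u) V′ ≐ colS (single u) W

-- Rooted trees on a vertex set given by representatives.
-- P : which representatives are vertices, _≈_ : when two representatives
-- denote the same vertex, D : directed edges.

module _ (P : ℕ → Set) (_≈_ : ℕ → ℕ → Set) where

  Connected : (ℕ → ℕ → Set) → Set
  Connected Adj = ∀ x y → P x → P y →
    Star (λ a b → P a × P b × (a ≈ b ⊎ Adj a b)) x y

  IsCycle : (ℕ → ℕ → Set) → List ℕ → Set
  IsCycle Adj [] = ⊥
  IsCycle Adj (x ∷ ys) = 2 ≤ length ys × All P (x ∷ ys) ×
    AllPairs (λ a b → ¬ a ≈ b) (x ∷ ys) × Linked Adj ((x ∷ ys) ∷ʳ x)

  IsTree : (ℕ → ℕ → Set) → Set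
  IsTree Adj = Connected Adj × (∀ xs → ¬ IsCycle Adj xs)

  RedEdge : (ℕ → ℕ → Set) → ℕ → ℕ → Set
  RedEdge D x y = D x y × ¬ (∃[ z ] (P z × D x z × D z y))

  IsRootOf : (ℕ → ℕ → Set) → ℕ → Set
  IsRootOf D r = P r × (∀ x → P x → ¬ x ≈ r → D r x)

  record RootedTree (D : ℕ → ℕ → Set) : Set where
    field
      transitive : ∀ x y z → P x → P y → P z → D x y → D y z → D x z
      reduction-tree : IsTree (λ x y → RedEdge D x y ⊎ RedEdge D y x)
      root : ∃[ r ] IsRootOf D r

-- The levels M_k(H) of an induced subgraph H (given by its vertex list).
-- Members of 𝒱_k are represented by vertices of H: u represents the block
-- Block k u, and Same k u v says u, v lie in the same block of 𝒱_k.

module Levels (G : Multigraph) (H : List ℕ) where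
  open Multigraph G

  Same : ℕ → ℕ → ℕ → Set
  Block : ℕ → ℕ → VSet

  Same zero u v = u ≡ v
  Same (suc k) = EqClosure (λ u v → u ∈ H × v ∈ H ×
    (Same k u v ⊎ Dom G (Block k u) (Block k v) ⊎ Dom G (Block k v) (Block k u)))

  Block k u x = x ∈ H × Same k x u

  Arr : ℕ → ℕ → ℕ → Set
  Arr k u w = ¬ Same k u w × Dom G (Block k u) (Block k w)

  Edge : ℕ → ℕ → ℕ → Set
  Edge k u w = ¬ Same k u w × Card1 (colS G (Block k u) (Block k w))

  ExactlyOne : Set → Set → Set → Set
  ExactlyOne A B C = (A ⊎ B ⊎ C) × ¬ (A × B) × ¬ (A × C) × ¬ (B × C)

  -- vertices of the weak component of M_k(H) containing (the block of) c
  InComp : ℕ → ℕ → ℕ → Set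
  InComp k c u = u ∈ H × Same (suc k) u c

  TreePropAt : ℕ → Set
  TreePropAt k =
      (∀ u w → u ∈ H → w ∈ H → ¬ Same k u w →
         ExactlyOne (Edge k u w) (Arr k u w) (Arr k w u))
    × (∀ u w → u ∈ H → w ∈ H → Edge k u w → Card1 (colS G (Block k u) (Block k w)))
    × (∀ u w → u ∈ H → w ∈ H → Arr k u w → Card2 (colS G (Block k u) (Block k w)))
    × (∀ c → c ∈ H → RootedTree (InComp k c) (Same k) (Arr k))
    × (∀ u v w → u ∈ H → v ∈ H → w ∈ H → Arr k u v → Arr k v w →
         SameSig G (Block k u) (Block k v) (Block k w))

  TreeProperty : ℕ → Set
  TreeProperty n = ∀ k → k ≤ n → TreePropAt k

  tc₀ : ℕ → ColorSet
  tc₀ u c = ∃[ v ] (v ∈ H × Arr zero u v × c ∈ ρ u v)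

  -- IsTC k u C : C = tc(U) for the block U ∈ 𝒱_k represented by u,
  -- where tc(U) = tc(rt(U)) and rt(U) is the root of tr(U).
  IsTC : ℕ → ℕ → ColorSet → Set
  IsTC zero u C = C ≐ tc₀ u
  IsTC (suc k) u C = ∃[ r ] (IsRootOf (InComp k u) (Same k) (Arr k) r × IsTC k r C)

module Submission where

-- Call a level k "root-coloured" if for every arrow (R,X) ∈ 𝒜_k
-- the colours ρ[RX] are exactly tc(R).  We prove by induction on n that
-- every level n ≤ (tree property bound) is root-coloured; the theorem is the
-- successor step applied once more.
--
-- * Level 0: all arrows r ▷ x, r ▷ y leaving one vertex carry the same
--   colours (via the signature condition when x, y are joined by an arrow, and
--   via the absence of rainbow triangles when they are joined by an edge), so
--   ρ[rx] is the union tc(r) of all of them.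
-- * Step n → n+1: let (U,V) ∈ 𝒜_{n+1} and let R = rt(U).  Every block W ⊆ U
--   of 𝒱_n is joined to V by an edge of M_n, so ρ[WV] is one colour.  Let c_R
--   be that colour for R; since |ρ[UV]| > 1 some block X ⊆ U sees V in a
--   colour c ≠ c_R, so X ≠ R and R ▷ X.  A rainbow-triangle argument bounds
--   ρ[RX] ⊆ {c, c_R}, and |ρ[RX]| = 2 gives equality.  By induction
--   ρ[RX] = tc(R) = tc(U), and the same argument for every W ⊆ U shows
--   ρ[UV] = {c, c_R}.
-- Existence of tc(U) just follows the roots of the rooted trees down the levels.

open import Defs
open import Data.Nat using (ℕ; suc; zero; z≤n; _≟_)
open import Data.Nat.Properties using (≤-refl; m≤n⇒m≤1+n; n≤1+n)
open import Data.List using (List)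
open import Data.List.Membership.Propositional using (_∈_)
open import Data.List.Membership.DecPropositional _≟_ using (_∈?_)
open import Data.Product using (∃-syntax; _×_; _,_; proj₁; proj₂)
open import Data.Sum using (_⊎_; inj₁; inj₂)
open import Data.Empty using (⊥; ⊥-elim)
open import Function using (id)
open import Relation.Nullary using (¬_; yes; no)
open import Relation.Binary.PropositionalEquality using (_≡_; _≢_; refl; sym; trans; subst)
open import Relation.Binary.Construct.Closure.ReflexiveTransitive using (ε; _◅_)
import Relation.Binary.Construct.Closure.Equivalence as EqClosure
import Relation.Binary.Construct.Closure.Symmetric as SymClosure

Pair : ℕ → ℕ → ColorSet
Pair a b k = k ≡ a ⊎ k ≡ b

≐-sym : ∀ {S T} → S ≐ T → T ≐ S
≐-sym S≐T c = proj₂ (S≐T c) , proj₁ (S≐T c)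

≐-trans : ∀ {S T W} → S ≐ T → T ≐ W → S ≐ W
≐-trans S≐T T≐W c = (λ Sc → proj₁ (T≐W c) (proj₁ (S≐T c) Sc)) ,
                    (λ Wc → proj₂ (S≐T c) (proj₂ (T≐W c) Wc))

pair-card2 : ∀ {S a b} → a ≢ b → S ≐ Pair a b → Card2 S
pair-card2 {a = a} {b} a≢b S≐ab =
  a , b , a≢b , proj₂ (S≐ab a) (inj₁ refl) , proj₂ (S≐ab b) (inj₂ refl) ,
  λ k Sk → proj₁ (S≐ab k) Sk

card2-in-pair : ∀ {S a b} → Card2 S → (∀ k → S k → Pair a b k) → S ≐ Pair a b
card2-in-pair {S} {a} {b} (p , q , p≢q , Sp , Sq , _) S⊆ab = λ k → S⊆ab k , ab⊆S k
  where
    Sa×Sb : S a × S b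
    Sa×Sb with S⊆ab p Sp | S⊆ab q Sq
    ... | inj₁ refl | inj₁ refl = ⊥-elim (p≢q refl)
    ... | inj₁ refl | inj₂ refl = Sp , Sq
    ... | inj₂ refl | inj₁ refl = Sq , Sp
    ... | inj₂ refl | inj₂ refl = ⊥-elim (p≢q refl)
    ab⊆S : ∀ k → Pair a b k → S k
    ab⊆S k (inj₁ refl) = proj₁ Sa×Sb
    ab⊆S k (inj₂ refl) = proj₂ Sa×Sb

card2-avoid : ∀ {S : ColorSet} → Card2 S → ∀ t → ∃[ z ] (S z × z ≢ t)
card2-avoid (p , q , p≢q , Sp , Sq , _) t with p ≟ t
... | yes refl = q , Sq , λ q≡p → p≢q (sym q≡p)
... | no p≢t   = p , Sp , p≢t

module RootColours (G : Multigraph) (gallai : Gallai G) (H : List ℕ)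
                   (H⊆V : ∀ x → x ∈ H → x ∈ Multigraph.V G) where
  open Multigraph G
  open Levels G H

  no-rainbow : ∀ {x y z a b c} → x ∈ H → y ∈ H → z ∈ H → x ≢ y → y ≢ z → x ≢ z →
               a ∈ ρ x y → b ∈ ρ y z → c ∈ ρ x z → a ≢ b → b ≢ c → a ≢ c → ⊥
  no-rainbow {x} {y} {z} {a} {b} {c} xH yH zH x≢y y≢z x≢z a∈ b∈ c∈ a≢b b≢c a≢c =
    gallai x y z (H⊆V x xH) (H⊆V y yH) (H⊆V z zH) x≢y y≢z x≢z
           (a , b , c , a∈ , b∈ , c∈ , a≢b , b≢c , a≢c)

  Joined : ℕ → ℕ → ℕ → Set
  Joined k u v = u ∈ H × v ∈ H ×
    (Same k u v ⊎ Dom G (Block k u) (Block k v) ⊎ Dom G (Block k v) (Block k u))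

  same-refl : ∀ k x → Same k x x
  same-refl zero    x = refl
  same-refl (suc k) x = ε

  same-sym : ∀ k {x y} → Same (suc k) x y → Same (suc k) y x
  same-sym k = EqClosure.symmetric (Joined k)

  same-trans : ∀ k {x y z} → Same (suc k) x y → Same (suc k) y z → Same (suc k) x z
  same-trans k = EqClosure.transitive (Joined k)

  joined⇒same : ∀ k {x y} → Joined k x y → Same (suc k) x y
  joined⇒same k j = SymClosure.fwd j ◅ ε

  same-lift : ∀ k {x y} → x ∈ H → y ∈ H → Same k x y → Same (suc k) x y
  same-lift k xH yH s = joined⇒same k (xH , yH , inj₁ s)

  module _ {k : ℕ} (tp : TreePropAt k) where
    trichotomy : ∀ u w → u ∈ H → w ∈ H → ¬ Same k u w →
                 Edge k u w ⊎ Arr k u w ⊎ Arr k w u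
    trichotomy u w uH wH u≁w = proj₁ (proj₁ tp u w uH wH u≁w)

    arrow-card2 : ∀ u w → u ∈ H → w ∈ H → Arr k u w →
                  Card2 (colS G (Block k u) (Block k w))
    arrow-card2 = proj₁ (proj₂ (proj₂ tp))

    component-tree : ∀ c → c ∈ H → RootedTree (InComp k c) (Same k) (Arr k)
    component-tree = proj₁ (proj₂ (proj₂ (proj₂ tp)))

    signature : ∀ u v w → u ∈ H → v ∈ H → w ∈ H → Arr k u v → Arr k v w →
                SameSig G (Block k u) (Block k v) (Block k w)
    signature = proj₂ (proj₂ (proj₂ (proj₂ tp)))

  -- At level 0 blocks (and singletons) are single vertices, so block colours
  -- are edge colours.
  block₀-colour : ∀ {r x c} → colS G (Block zero r) (Block zero x) c → c ∈ ρ r x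
  block₀-colour (_ , _ , (_ , refl) , (_ , refl) , _ , c∈) = c∈

  single-colour : ∀ {r x c} → colS G (single G r) (Block zero x) c → c ∈ ρ r x
  single-colour (_ , _ , refl , (_ , refl) , _ , c∈) = c∈

  RootColoured : ℕ → Set₁
  RootColoured k = ∀ r x → r ∈ H → x ∈ H → Arr k r x → ∀ C → IsTC k r C →
                   colS G (Block k r) (Block k x) ≐ C

  module _ (tp : TreePropAt zero) where
    -- Two arrows r ▷ x, r ▷ y whose heads are joined by a one-coloured edge:
    -- a colour of ρ[ry] missing from ρ[rx] would yield a rainbow triangle rxy.
    edge-between-heads : ∀ r x y → r ∈ H → x ∈ H → y ∈ H →
      Arr zero r x → Arr zero r y → x ≢ y → Edge zero x y →
      ∀ c → c ∈ ρ r y → c ∈ ρ r x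
    edge-between-heads r x y rH xH yH r▷x r▷y x≢y (_ , e , e∈ , _) c c∈ry
      with c ∈? ρ r x
    ... | yes c∈rx = c∈rx
    ... | no c∉rx with c ≟ e
    ...   | no c≢e = ⊥-elim
      (let (α , α∈ , α≢e) = card2-avoid (arrow-card2 tp r x rH xH r▷x) e in
       no-rainbow rH xH yH (proj₁ r▷x) x≢y (proj₁ r▷y)
         (block₀-colour α∈) (block₀-colour e∈) c∈ry
         α≢e (λ e≡c → c≢e (sym e≡c)) (λ α≡c → c∉rx (subst (_∈ ρ r x) α≡c (block₀-colour α∈))))
    ...   | yes refl = ⊥-elim
      (let (d , d∈ , d≢c) = card2-avoid (arrow-card2 tp r y rH yH r▷y) c
           (α , α∈ , α≢d) = card2-avoid (arrow-card2 tp r x rH xH r▷x) d in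
       no-rainbow rH xH yH (proj₁ r▷x) x≢y (proj₁ r▷y)
         (block₀-colour α∈) (block₀-colour e∈) (block₀-colour d∈)
         (λ α≡c → c∉rx (subst (_∈ ρ r x) α≡c (block₀-colour α∈)))
         (λ c≡d → d≢c (sym c≡d)) α≢d)

    arrows-from-vertex : ∀ r x y → r ∈ H → x ∈ H → y ∈ H →
      Arr zero r x → Arr zero r y → ∀ c → c ∈ ρ r y → c ∈ ρ r x
    arrows-from-vertex r x y rH xH yH r▷x r▷y c c∈ry with x ≟ y
    ... | yes refl = c∈ry
    ... | no x≢y with trichotomy tp x y xH yH x≢y
    ...   | inj₁ edge = edge-between-heads r x y rH xH yH r▷x r▷y x≢y edge c c∈ry
    ...   | inj₂ (inj₁ x▷y) = single-colour
            (proj₂ (signature tp r x y rH xH yH r▷x x▷y r (rH , refl) c) r-y)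
      where r-y = r , y , refl , (yH , refl) , proj₁ r▷y , c∈ry
    ...   | inj₂ (inj₂ y▷x) = single-colour
            (proj₁ (signature tp r y x rH yH xH r▷y y▷x r (rH , refl) c) r-y)
      where r-y = r , y , refl , (yH , refl) , proj₁ r▷y , c∈ry

    root-coloured₀ : RootColoured zero
    root-coloured₀ r x rH xH r▷x C C≐tc c =
      (λ c∈rx → proj₂ (C≐tc c) (x , xH , r▷x , block₀-colour c∈rx)) ,
      (λ c∈C → let (y , yH , r▷y , c∈ry) = proj₁ (C≐tc c) c∈C in
         r , x , (rH , refl) , (xH , refl) , proj₁ r▷x ,
         arrows-from-vertex r x y rH xH yH r▷x r▷y c c∈ry)

  module Step (n : ℕ) (tp : TreePropAt n) (IH : RootColoured n)
              (u v : ℕ) (vH : v ∈ H) (U▷V : Arr (suc n) u v) where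
    U : VSet
    U = Block (suc n) u

    UV : ColorSet
    UV = colS G U (Block (suc n) v)

    outside-V : ∀ {w} → U w → ¬ Same (suc n) w v
    outside-V (_ , w~u) w~v = proj₁ U▷V (same-trans n (same-sym n w~u) w~v)

    ≢v : ∀ {w} → U w → w ≢ v
    ≢v Uw refl = outside-V Uw ε

    sub-block : ∀ {w x} → U w → Block n w x → U x
    sub-block (wH , w~u) (xH , x~w) = xH , same-trans n (same-lift n xH wH x~w) w~u

    -- Each block W ⊆ U of 𝒱_n is joined to v by an edge of M_n (an arrow would
    -- put W and v in one weak component), so ρ[W, Block v] is a single colour.
    edge-to-V : ∀ w → U w → Card1 (colS G (Block n w) (Block n v))
    edge-to-V w Uw@(wH , _)
      with trichotomy tp w v wH vH (λ w~v → outside-V Uw (same-lift n wH vH w~v))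
    ... | inj₁ (_ , one) = one
    ... | inj₂ (inj₁ w▷v) = ⊥-elim (outside-V Uw (joined⇒same n (wH , vH , inj₂ (inj₁ (proj₂ w▷v)))))
    ... | inj₂ (inj₂ v▷w) = ⊥-elim (outside-V Uw (joined⇒same n (wH , vH , inj₂ (inj₂ (proj₂ v▷w)))))

    colour-to-V : ∀ w → U w → ℕ
    colour-to-V w Uw = proj₁ (edge-to-V w Uw)

    colour-to-V-unique : ∀ w (Uw : U w) {w′ c} → Block n w w′ → c ∈ ρ w′ v →
                         c ≡ colour-to-V w Uw
    colour-to-V-unique w Uw W-w′ c∈ =
      proj₂ (proj₂ (edge-to-V w Uw)) _
            (_ , v , W-w′ , (vH , same-refl n v) , ≢v (sub-block Uw W-w′) , c∈)

    -- Every colour of ρ[UV] is already seen from v: by the definition of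
    -- dominance all vertices of V have the same colours towards a vertex of U.
    seen-from-v : ∀ c → UV c → ∃[ w ] (U w × c ∈ ρ w v)
    seen-from-v c (u′ , v′ , Uu′ , Vv′ , u′≢v′ , c∈) with proj₂ (proj₂ U▷V)
    ... | inj₁ (_ , _ , _ , (_ , V-single) , _)
        with V-single v′ Vv′ | V-single v (vH , ε)
    ...   | refl | refl = u′ , Uu′ , c∈
    seen-from-v c (u′ , v′ , Uu′ , Vv′ , u′≢v′ , c∈) | inj₂ (_ , sig)
        with proj₁ (sig u′ v′ Uu′ Vv′ c) (u′ , v′ , refl , refl , u′≢v′ , c∈)
    ... | u″ , v″ , refl , Vv″ , u′≢v″ , c∈′
        with proj₂ (sig u′ v Uu′ (vH , ε) c) (u′ , v″ , refl , Vv″ , u′≢v″ , c∈′)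
    ... | _ , _ , refl , refl , _ , c∈ᵥ = u′ , Uu′ , c∈ᵥ

    -- From now on R = rt(U) is the root of tr(U), represented by r, and
    -- c_R is the colour between R and V.
    module _ (r : ℕ) (root : IsRootOf (InComp n u) (Same n) (Arr n) r) where
      Ur : U r
      Ur = proj₁ root

      rH : r ∈ H
      rH = proj₁ Ur

      cR : ℕ
      cR = colour-to-V r Ur

      RX : ℕ → ColorSet
      RX x = colS G (Block n r) (Block n x)

      -- A block seeing V in a colour other than c_R is not the root block,
      -- hence is dominated by it.
      root▷ : ∀ w → U w → ∀ {a} → a ∈ ρ w v → a ≢ cR → Arr n r w
      root▷ w Uw a∈ a≢cR =
        proj₂ root w Uw (λ w~r → a≢cR (colour-to-V-unique r Ur (proj₁ Uw , w~r) a∈))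

      -- If X ⊆ U sees V in colour a ≠ c_R then ρ[RX] ⊆ {a, c_R}: any other
      -- colour would form a rainbow triangle with vertices in R, X and v.
      root-colours-in-pair : ∀ x → U x → ∀ {a} → a ∈ ρ x v → a ≢ cR →
                             ∀ k → RX x k → Pair a cR k
      root-colours-in-pair x Ux {a} a∈ a≢cR k (r′ , x′ , R-r′ , X-x′ , r′≢x′ , k∈)
        with k ≟ a | k ≟ cR
      ... | yes k≡a | _ = inj₁ k≡a
      ... | no _ | yes k≡cR = inj₂ k≡cR
      ... | no k≢a | no k≢cR = ⊥-elim
          (let Ur′ = sub-block Ur R-r′
               Ux′ = sub-block Ux X-x′
               (d , d∈) = ρ-nonempty r′ v (H⊆V r′ (proj₁ Ur′)) (H⊆V v vH) (≢v Ur′)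
               (e , e∈) = ρ-nonempty x′ v (H⊆V x′ (proj₁ Ux′)) (H⊆V v vH) (≢v Ux′)
               d≡cR = colour-to-V-unique r Ur R-r′ d∈
               e≡a = trans (colour-to-V-unique x Ux X-x′ e∈)
                           (sym (colour-to-V-unique x Ux (proj₁ Ux , same-refl n x) a∈))
           in no-rainbow (proj₁ Ur′) (proj₁ Ux′) vH r′≢x′ (≢v Ux′) (≢v Ur′) k∈ e∈ d∈
                (λ k≡e → k≢a (trans k≡e e≡a))
                (λ e≡d → a≢cR (trans (sym e≡a) (trans e≡d d≡cR)))
                (λ k≡d → k≢cR (trans k≡d d≡cR)))

      -- Since |ρ[RX]| = 2 for the arrow R ▷ X, in fact ρ[RX] = {a, c_R}.
      root-arrow-pair : ∀ x → U x → ∀ {a} → a ∈ ρ x v → a ≢ cR → RX x ≐ Pair a cR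
      root-arrow-pair x Ux a∈ a≢cR =
        card2-in-pair (arrow-card2 tp r x rH (proj₁ Ux) (root▷ x Ux a∈ a≢cR))
                      (root-colours-in-pair x Ux a∈ a≢cR)

      -- As |ρ[UV]| > 1, some block of U sees V in a colour other than c_R.
      second-colour : ∃[ x ] (U x × ∃[ c ] (c ∈ ρ x v × c ≢ cR × UV c))
      second-colour with proj₁ (proj₂ U▷V)
      ... | a , b , UVa , UVb , a≢b with a ≟ cR
      ...   | no a≢cR  = let (w , Uw , a∈) = seen-from-v a UVa in w , Uw , a , a∈ , a≢cR , UVa
      ...   | yes refl = let (w , Uw , b∈) = seen-from-v b UVb in
                         w , Uw , b , b∈ , (λ b≡a → a≢b (sym b≡a)) , UVb

      cR-in-UV : UV cR
      cR-in-UV with proj₁ (proj₂ (edge-to-V r Ur))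
      ... | r′ , v′ , R-r′ , (v′H , v′~v) , r′≢v′ , c∈ =
        r′ , v′ , sub-block Ur R-r′ , (v′H , same-lift n v′H vH v′~v) , r′≢v′ , c∈

      -- ρ[UV] = {c, c_R} = ρ[RX] = tc(R) for the block X found above; every
      -- other colour of ρ[UV] lies in some ρ[RW] = tc(R) by the same argument.
      arrow-colours : ∀ C → IsTC n r C → (UV ≐ C) × Card2 C
      arrow-colours C tcR with second-colour
      ... | x , Ux , c , c∈ , c≢cR , UVc = ≐-trans UV≐pair (≐-sym C≐pair) , pair-card2 c≢cR C≐pair
        where
          tc-of : ∀ w → U w → ∀ {a} → a ∈ ρ w v → a ≢ cR → C ≐ Pair a cR
          tc-of w Uw a∈ a≢cR =
            ≐-trans (≐-sym (IH r w rH (proj₁ Uw) (root▷ w Uw a∈ a≢cR) C tcR))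
                    (root-arrow-pair w Uw a∈ a≢cR)

          C≐pair : C ≐ Pair c cR
          C≐pair = tc-of x Ux c∈ c≢cR

          UV⊆pair : ∀ k → UV k → Pair c cR k
          UV⊆pair k UVk with seen-from-v k UVk
          ... | w , Uw , k∈ with k ≟ cR
          ...   | yes k≡cR = inj₂ k≡cR
          ...   | no k≢cR  = proj₁ (C≐pair k) (proj₂ (tc-of w Uw k∈ k≢cR k) (inj₁ refl))

          pair⊆UV : ∀ k → Pair c cR k → UV k
          pair⊆UV k (inj₁ refl) = UVc
          pair⊆UV k (inj₂ refl) = cR-in-UV

          UV≐pair : UV ≐ Pair c cR
          UV≐pair k = UV⊆pair k , pair⊆UV k

  successor-arrow : ∀ n → TreePropAt n → RootColoured n →
    ∀ u v → v ∈ H → Arr (suc n) u v → ∀ C → IsTC (suc n) u C →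
    (colS G (Block (suc n) u) (Block (suc n) v) ≐ C) × Card2 C
  successor-arrow n tp IH u v vH U▷V C (r , root , tcR) =
    Step.arrow-colours n tp IH u v vH U▷V r root C tcR

  restrict : ∀ {m} → TreeProperty (suc m) → TreeProperty m
  restrict tpp k k≤m = tpp k (m≤n⇒m≤1+n k≤m)

  root-coloured : ∀ n → TreeProperty n → RootColoured n
  root-coloured zero    tpp = root-coloured₀ (tpp zero z≤n)
  root-coloured (suc m) tpp r x rH xH r▷x C tcR =
    proj₁ (successor-arrow m (tpp m (n≤1+n m)) (root-coloured m (restrict tpp))
                           r x xH r▷x C tcR)

  -- tc(U) exists: follow the roots of the rooted trees down to level 0.
  tc-exists : ∀ k → TreeProperty k → ∀ r → r ∈ H → ∃[ C ] IsTC (suc k) r C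
  tc-exists zero tpp r rH with RootedTree.root (component-tree (tpp zero z≤n) r rH)
  ... | r′ , isRoot = tc₀ r′ , r′ , isRoot , λ c → id , id
  tc-exists (suc k) tpp r rH with RootedTree.root (component-tree (tpp (suc k) ≤-refl) r rH)
  ... | r′ , isRoot with tc-exists k (restrict tpp) r′ (proj₁ (proj₁ isRoot))
  ...   | C , tcR′ = C , r′ , isRoot , tcR′

-- Lemma 2.6.
lemma2p6 : (G : Multigraph) → Gallai G → Maximal G → Reduced G →
    (H : List ℕ) → (∀ x → x ∈ H → x ∈ Multigraph.V G) →
    (n : ℕ) → Levels.TreeProperty G H n →
    ∀ u v → u ∈ H → v ∈ H → Levels.Arr G H (suc n) u v →
    (∃[ C ] Levels.IsTC G H (suc n) u C) ×
    (∀ C → Levels.IsTC G H (suc n) u C →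
       (colS G (Levels.Block G H (suc n) u) (Levels.Block G H (suc n) v) ≐ C) × Card2 C)
lemma2p6 G gallai _ _ H H⊆V n tpp u v uH vH U▷V =
  tc-exists n tpp u uH ,
  successor-arrow n (tpp n ≤-refl) (root-coloured n tpp) u v vH U▷V
  where open RootColours G gallai H H⊆V
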